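{- Let $G$ be any $K_4$-free graph and let $F=DR(G)$. Then: (1) $F$ has no spurious triangles; (2) $F$ is $J_4$-free; and (3) for every $r\ge 1$, $G\rightarrow(3^r)^e$ if and only if $F\rightarrow(3^r)^v$.
   Context: All graphs are finite, simple and undirected. $J_4$ is $K_4$ with one edge removed; $H$-free means containing no subgraph (not necessarily induced) isomorphic to $H$. For a graph $G=(V_G,E_G)$, the graph $DR(G)=F=(E_G,E_F)$ has vertex set $E_G$, and its edge set $E_F$ consists exactly of the pairs $\{e,f\},\{f,g\},\{e,g\}$ for every triple of edges $e,f,g\in E_G$ forming a triangle in $G$. A triangle $\{e,f,g\}$ of $F$ is an image triangle if $e,f,g$ form a triangle in $G$, and is spurious otherwise. $G\rightarrow(3^r)^e$ means every coloring of the edges of $G$ with $r$ colors contains a triangle of $G$ whose three edges have the same color; $F\rightarrow(3^r)^v$ means every coloring of the vertices of $F$ with $r$ colors contains a triangle of $F$ whose three vertices have the same color. -}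

module Defs where

open import Data.Nat using (ℕ)
open import Data.Bool using (Bool; true; false; T)
open import Data.Fin using (Fin; _<_)
open import Data.Product using (Σ; ∃; ∃-syntax; _×_; _,_; proj₁)
open import Data.Sum using (_⊎_)
open import Relation.Binary.PropositionalEquality using (_≡_; _≢_)
open import Relation.Nullary using (¬_)

-- A finite simple undirected graph on vertex set Fin n.
-- Adjacency is Bool-valued so that "u and v are adjacent" is a proposition.
record Graph (n : ℕ) : Set where
  field
    adj     : Fin n → Fin n → Bool
    symm    : ∀ u v → adj u v ≡ adj v u
    irrefl  : ∀ u → adj u u ≡ false

module _ {n : ℕ} (G : Graph n) where
  open Graph G

  Adj : Fin n → Fin n → Set
  Adj u v = T (adj u v)

  -- The edge set E_G: each edge {u,v} represented once, with u < v.
  Edge : Set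
  Edge = Σ (Fin n) λ u → Σ (Fin n) λ v → (u < v) × Adj u v

  src tgt : Edge → Fin n
  src (u , _ , _) = u
  tgt (_ , v , _) = v

  EdgeOn : Edge → Fin n → Fin n → Set
  EdgeOn e x y = (src e ≡ x × tgt e ≡ y) ⊎ (src e ≡ y × tgt e ≡ x)

  EdgeTriangle : Edge → Edge → Edge → Set
  EdgeTriangle e f g = ∃[ a ] ∃[ b ] ∃[ c ] (EdgeOn e a b × EdgeOn f b c × EdgeOn g a c)

  EdgeArrows : ℕ → Set
  EdgeArrows r = (col : Edge → Fin r) →
    ∃[ e ] ∃[ f ] ∃[ g ] (EdgeTriangle e f g × col e ≡ col f × col f ≡ col g)

  DRAdj : Edge → Edge → Set
  DRAdj e f = ∃[ g ] EdgeTriangle e f g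

module _ {V : Set} (R : V → V → Set) where

  IsTriangle : V → V → V → Set
  IsTriangle x y z = x ≢ y × y ≢ z × x ≢ z × R x y × R y z × R x z

  HasK4 : Set
  HasK4 = ∃[ a ] ∃[ b ] ∃[ c ] ∃[ d ]
    (a ≢ b × a ≢ c × a ≢ d × b ≢ c × b ≢ d × c ≢ d ×
     R a b × R a c × R a d × R b c × R b d × R c d)

  K4-free : Set
  K4-free = ¬ HasK4

  -- contains J4 = K4 minus the edge cd as a (not necessarily induced) subgraph
  HasJ4 : Set
  HasJ4 = ∃[ a ] ∃[ b ] ∃[ c ] ∃[ d ]
    (a ≢ b × a ≢ c × a ≢ d × b ≢ c × b ≢ d × c ≢ d ×
     R a b × R a c × R a d × R b c × R b d)

  J4-free : Set
  J4-free = ¬ HasJ4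

  VertexArrows : ℕ → Set
  VertexArrows r = (col : V → Fin r) →
    ∃[ x ] ∃[ y ] ∃[ z ] (IsTriangle x y z × col x ≡ col y × col y ≡ col z)

NoSpuriousTriangles : {n : ℕ} (G : Graph n) → Set
NoSpuriousTriangles G =
  ∀ e f g → IsTriangle (DRAdj G) e f g → EdgeTriangle G e f g

{-# OPTIONS --safe #-}
module Submission where

-- Two edges adjacent in F = DR(G) share exactly one endpoint, and their other
-- endpoints are adjacent in G.  Let e, f, g be a triangle of F and p, q, s the
-- common endpoints of ef, fg and eg.  If two of p, q, s coincide, all three
-- edges leave one vertex v and their other endpoints are pairwise adjacent, so
-- together with v they span a K4.  Otherwise e = sp, f = pq and g = sq form a
-- triangle of G.  Hence every triangle of F is an image triangle; as a pair of
-- edges lies in at most one triangle of G, F is J4-free, and monochromatic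
-- triangles of G and of F correspond under every colouring.

open import Defs
open import Data.Nat using (ℕ; _≤_)
open import Data.Product using (_×_; _,_; ∃-syntax)
open import Data.Sum using (_⊎_; inj₁; inj₂)
open import Data.Bool using (T)
open import Data.Bool.Properties using (T-irrelevant)
open import Data.Fin using (Fin; _≟_)
open import Data.Fin.Properties using (<-irrelevant; <-asym; <⇒≢)
open import Data.Empty using (⊥-elim)
open import Function.Bundles using (_⇔_; mk⇔)
open import Relation.Nullary using (yes; no)
open import Relation.Binary.PropositionalEquality using (_≡_; refl; subst; _≢_; ≢-sym)

module _ {n : ℕ} (G : Graph n) where
  open Graph G

  Adj⇒≢ : ∀ {x y} → Adj G x y → x ≢ y
  Adj⇒≢ {x} xy refl = subst T (irrefl x) xy

  EdgeOn⇒≢ : ∀ e {x y} → EdgeOn G e x y → x ≢ y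
  EdgeOn⇒≢ (_ , _ , u<v , _) (inj₁ (refl , refl)) = <⇒≢ u<v
  EdgeOn⇒≢ (_ , _ , u<v , _) (inj₂ (refl , refl)) = ≢-sym (<⇒≢ u<v)

  EdgeOn⇒Adj : ∀ e {x y} → EdgeOn G e x y → Adj G x y
  EdgeOn⇒Adj (_ , _ , _ , uv) (inj₁ (refl , refl)) = uv
  EdgeOn⇒Adj (u , v , _ , uv) (inj₂ (refl , refl)) = subst T (symm u v) uv

  EdgeOn-sym : ∀ e {x y} → EdgeOn G e x y → EdgeOn G e y x
  EdgeOn-sym _ (inj₁ p) = inj₂ p
  EdgeOn-sym _ (inj₂ p) = inj₁ p

  EdgeOn-injective : ∀ e f {x y} → EdgeOn G e x y → EdgeOn G f x y → e ≡ f
  EdgeOn-injective (_ , _ , u<v , uv) (_ , _ , u<v′ , uv′) (inj₁ (refl , refl)) (inj₁ (refl , refl))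
    rewrite <-irrelevant u<v u<v′ | T-irrelevant uv uv′ = refl
  EdgeOn-injective (_ , _ , u<v , _) (_ , _ , v<u , _) (inj₁ (refl , refl)) (inj₂ (refl , refl)) = ⊥-elim (<-asym u<v v<u)
  EdgeOn-injective (_ , _ , u<v , _) (_ , _ , v<u , _) (inj₂ (refl , refl)) (inj₁ (refl , refl)) = ⊥-elim (<-asym u<v v<u)
  EdgeOn-injective (_ , _ , u<v , uv) (_ , _ , u<v′ , uv′) (inj₂ (refl , refl)) (inj₂ (refl , refl))
    rewrite <-irrelevant u<v u<v′ | T-irrelevant uv uv′ = refl

  EdgeOn-endpoints : ∀ e {x y x′ y′} → EdgeOn G e x y → EdgeOn G e x′ y′ →
    (x ≡ x′ × y ≡ y′) ⊎ (x ≡ y′ × y ≡ x′)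
  EdgeOn-endpoints _ (inj₁ (refl , refl)) (inj₁ (refl , refl)) = inj₁ (refl , refl)
  EdgeOn-endpoints _ (inj₁ (refl , refl)) (inj₂ (refl , refl)) = inj₂ (refl , refl)
  EdgeOn-endpoints _ (inj₂ (refl , refl)) (inj₁ (refl , refl)) = inj₂ (refl , refl)
  EdgeOn-endpoints _ (inj₂ (refl , refl)) (inj₂ (refl , refl)) = inj₁ (refl , refl)

  Incident : Edge G → Fin n → Set
  Incident e x = ∃[ y ] EdgeOn G e x y

  EdgeOn-from-incident : ∀ e {x y} → Incident e x → Incident e y → x ≢ y → EdgeOn G e x y
  EdgeOn-from-incident e (_ , ex) (_ , ey) x≢y with EdgeOn-endpoints e ex ey
  ... | inj₁ (x≡y , _)    = ⊥-elim (x≢y x≡y)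
  ... | inj₂ (_ , refl)   = ex

  EdgeOn-≢ : ∀ e f {a b c} → EdgeOn G e a b → EdgeOn G f b c → a ≢ c → e ≢ f
  EdgeOn-≢ e _ eab fbc a≢c refl with EdgeOn-endpoints e eab fbc
  ... | inj₁ (a≡b , _) = EdgeOn⇒≢ e eab a≡b
  ... | inj₂ (a≡c , _) = a≢c a≡c

  EdgeTriangle⇒IsTriangle : ∀ e f g → EdgeTriangle G e f g → IsTriangle (DRAdj G) e f g
  EdgeTriangle⇒IsTriangle e f g (a , b , c , eab , fbc , gac) =
    EdgeOn-≢ e f eab fbc (EdgeOn⇒≢ g gac) ,
    EdgeOn-≢ f g fbc (EdgeOn-sym g gac) (EdgeOn⇒≢ e (EdgeOn-sym e eab)) ,
    EdgeOn-≢ e g (EdgeOn-sym e eab) gac (EdgeOn⇒≢ f fbc) ,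
    (g , a , b , c , eab , fbc , gac) ,
    (e , b , c , a , fbc , EdgeOn-sym g gac , EdgeOn-sym e eab) ,
    (f , b , a , c , EdgeOn-sym e eab , gac , fbc)

  EdgeTriangle-third-unique : ∀ e f g g′ → EdgeTriangle G e f g → EdgeTriangle G e f g′ → g ≡ g′
  EdgeTriangle-third-unique e f g g′ (a , b , c , eab , fbc , gac) (a′ , b′ , c′ , eab′ , fbc′ , gac′)
    with EdgeOn-endpoints e eab eab′ | EdgeOn-endpoints f fbc fbc′
  ... | inj₁ (refl , refl) | inj₁ (_ , refl) = EdgeOn-injective g g′ gac gac′
  ... | inj₁ (_ , refl)    | inj₂ (b≡c′ , _) = ⊥-elim (EdgeOn⇒≢ f fbc′ b≡c′)
  ... | inj₂ (_ , refl)    | inj₁ (refl , _) = ⊥-elim (EdgeOn⇒≢ e eab′ refl)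
  ... | inj₂ (refl , refl) | inj₂ (_ , refl) = ⊥-elim (EdgeOn⇒≢ g gac refl)

  DRAdj⇒common-endpoint : ∀ e f → DRAdj G e f → ∃[ v ] (Incident e v × Incident f v)
  DRAdj⇒common-endpoint e _ (_ , a , b , c , eab , fbc , _) = b , (a , EdgeOn-sym e eab) , (c , fbc)

  -- Distinct edges share at most one endpoint, so the triangle witnessing
  -- DRAdj e f is the one on v, a and c.
  DRAdj⇒Adj : ∀ e f {v a c} → e ≢ f → DRAdj G e f →
    EdgeOn G e v a → EdgeOn G f v c → Adj G a c
  DRAdj⇒Adj e f e≢f (h , x , y , z , exy , fyz , hxz) eva fvc
    with EdgeOn-endpoints e eva exy | EdgeOn-endpoints f fvc fyz
  ... | inj₂ (refl , refl) | inj₁ (refl , refl) = EdgeOn⇒Adj h hxz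
  ... | inj₁ (refl , refl) | inj₁ (refl , _)    = ⊥-elim (EdgeOn⇒≢ e eva refl)
  ... | inj₂ (refl , refl) | inj₂ (refl , _)    = ⊥-elim (EdgeOn⇒≢ f fyz refl)
  ... | inj₁ (refl , refl) | inj₂ (refl , refl) =
          ⊥-elim (e≢f (EdgeOn-injective e f exy (EdgeOn-sym f fyz)))

  star⇒HasK4 : ∀ e f g {v} → IsTriangle (DRAdj G) e f g →
    Incident e v → Incident f v → Incident g v → HasK4 (Adj G)
  star⇒HasK4 e f g {v} (e≢f , f≢g , e≢g , ef , fg , eg) (a , eva) (c , fvc) (d , gvd) =
    v , a , c , d ,
    Adj⇒≢ va , Adj⇒≢ vc , Adj⇒≢ vd , Adj⇒≢ ac , Adj⇒≢ ad , Adj⇒≢ cd ,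
    va , vc , vd , ac , ad , cd
    where
      va = EdgeOn⇒Adj e eva
      vc = EdgeOn⇒Adj f fvc
      vd = EdgeOn⇒Adj g gvd
      ac = DRAdj⇒Adj e f e≢f ef eva fvc
      ad = DRAdj⇒Adj e g e≢g eg eva gvd
      cd = DRAdj⇒Adj f g f≢g fg fvc gvd

  noSpuriousTriangles : K4-free (Adj G) → NoSpuriousTriangles G
  noSpuriousTriangles k4-free e f g t@(_ , _ , _ , ef , fg , eg)
    with DRAdj⇒common-endpoint e f ef | DRAdj⇒common-endpoint f g fg | DRAdj⇒common-endpoint e g eg
  ... | p , e∋p , f∋p | q , f∋q , g∋q | s , e∋s , g∋s with p ≟ q | q ≟ s | p ≟ s
  ... | yes refl | _        | _        = ⊥-elim (k4-free (star⇒HasK4 e f g t e∋p f∋p g∋q))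
  ... | _        | yes refl | _        = ⊥-elim (k4-free (star⇒HasK4 e f g t e∋s f∋q g∋q))
  ... | _        | _        | yes refl = ⊥-elim (k4-free (star⇒HasK4 e f g t e∋p f∋p g∋s))
  ... | no p≢q   | no q≢s   | no p≢s   =
          s , p , q ,
          EdgeOn-from-incident e e∋s e∋p (≢-sym p≢s) ,
          EdgeOn-from-incident f f∋p f∋q p≢q ,
          EdgeOn-from-incident g g∋s g∋q (≢-sym q≢s)

  J4-free-DR : K4-free (Adj G) → J4-free (DRAdj G)
  J4-free-DR k4-free (e , f , g , g′ , e≢f , e≢g , e≢g′ , f≢g , f≢g′ , g≢g′ , ef , eg , eg′ , fg , fg′) =
    g≢g′ (EdgeTriangle-third-unique e f g g′
      (noSpuriousTriangles k4-free e f g (e≢f , f≢g , e≢g , ef , fg , eg))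
      (noSpuriousTriangles k4-free e f g′ (e≢f , f≢g′ , e≢g′ , ef , fg′ , eg′)))

  EdgeArrows⇒VertexArrows : ∀ r → EdgeArrows G r → VertexArrows (DRAdj G) r
  EdgeArrows⇒VertexArrows r arrows col with arrows col
  ... | e , f , g , t , col-e≡f , col-f≡g = e , f , g , EdgeTriangle⇒IsTriangle e f g t , col-e≡f , col-f≡g

  VertexArrows⇒EdgeArrows : K4-free (Adj G) → ∀ r → VertexArrows (DRAdj G) r → EdgeArrows G r
  VertexArrows⇒EdgeArrows k4-free r arrows col with arrows col
  ... | e , f , g , t , col-e≡f , col-f≡g = e , f , g , noSpuriousTriangles k4-free e f g t , col-e≡f , col-f≡g

lemma8 : {n : ℕ} (G : Graph n) → K4-free (Adj G) →
    NoSpuriousTriangles G × J4-free (DRAdj G) ×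
    ((r : ℕ) → 1 ≤ r → (EdgeArrows G r ⇔ VertexArrows (DRAdj G) r))
lemma8 G k4-free =
  noSpuriousTriangles G k4-free ,
  J4-free-DR G k4-free ,
  λ r _ → mk⇔ (EdgeArrows⇒VertexArrows G r) (VertexArrows⇒EdgeArrows G k4-free r)
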